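{- Let $G$ be a Whitney-maximum graph in $\mathcal{C}_{n,m}$. Then $G$ is a $k$-uniformly most reliable graph for every $k\in\{1,2,\ldots,n\}$. Moreover, for each $k\in\{1,2,\ldots,n\}$, $\lambda^{(k)}(G)\ge\lambda^{(k)}(H)$ and $t_k(G)\ge t_k(H)$ for every $H\in\mathcal{C}_{n,m}$.
   Context: $\mathcal{C}_{n,m}$ denotes the set of all connected simple graphs on $n$ vertices and $m$ edges. For a graph on $n$ vertices with $e$ edges and $\kappa$ connected components, its rank is $n-\kappa$ and its corank is $e-n+\kappa$; write $r(\cdot)$, $c(\cdot)$. $\mathcal{S}(G)$ is the set of spanning subgraphs of $G$. The Whitney polynomial is $W_G(x,y)=\sum_{H\in\mathcal{S}(G)}x^{r(G)-r(H)}y^{c(H)}$. A bivariate polynomial is nonnegative if it can be written as $\sum_{i,j}a_{ij}x^iy^j$ with finitely many real coefficients $a_{ij}\ge 0$. $G\in\mathcal{C}_{n,m}$ is Whitney-maximum if for every $H\in\mathcal{C}_{n,m}$ there is a nonnegative polynomial $Q_H$ with $W_G(x,y)-W_H(x,y)=(1-xy)Q_H(x,y)$. $N_i^{(k)}(G)$ is the number of spanning subgraphs of $G$ having exactly $i$ edges and at most $k$ connected components. For $k\in\{1,\ldots,n\}$ and $p\in[0,1]$, the $k$-reliability of $G$ is $R_G^{(k)}(p)=\sum_{i=0}^m N_i^{(k)}(G)p^i(1-p)^{m-i}$ (the probability that $G$ has at most $k$ components when each edge is independently retained with probability $p$). $G\in\mathcal{C}_{n,m}$ is a $k$-uniformly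 most reliable graph if $R_G^{(k)}(p)\ge R_H^{(k)}(p)$ for all $H\in\mathcal{C}_{n,m}$ and all $p\in[0,1]$. The $k$-order edge connectivity $\lambda^{(k)}(G)$ is the minimum number of edges that must be removed from $G$ to obtain a spanning subgraph with more than $k$ connected components (with the convention that the minimum over an empty set is $+\infty$). $t_k(G)$ is the number of spanning forests of $G$ consisting of exactly $k$ trees.
   Formalization: The probability p in the definition of a $k$-uniformly most reliable graph ranges over the rationals in [0,1] rather than over all reals in [0,1]. -}

module Defs where

open import Data.Nat as ℕ using (ℕ; zero; suc; _∸_; _<ᵇ_; _≡ᵇ_)
open import Data.Bool using (Bool; true; false; _∧_; _∨_; not; if_then_else_)
open import Data.Fin using (Fin; toℕ)
open import Data.Fin.Properties using (_≟_)
open import Data.List using (List; []; _∷_; length; allFin; map; upTo; foldr; _++_)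
open import Data.Bool.ListAction using (any)
open import Data.List.Relation.Unary.All using (All)
open import Data.List.Relation.Unary.Unique.Propositional using (Unique)
open import Data.Maybe using (Maybe; just; nothing)
open import Data.Product using (_×_; _,_; Σ; ∃; ∃-syntax; proj₁; proj₂)
open import Data.Sum using (_⊎_)
open import Data.Integer using (+_)
open import Data.Rational as ℚ using (ℚ; 0ℚ; 1ℚ)
open import Relation.Nullary.Decidable using (⌊_⌋)
open import Relation.Binary.PropositionalEquality using (_≡_)

-- An edge is a pair (u , v) with toℕ u < toℕ v (no loops, one orientation),
-- and the edge list has no repetitions (no multi-edges): simple graphs.

Edge : ℕ → Set
Edge n = Fin n × Fin n

_==_ : ∀ {n} → Fin n → Fin n → Bool
u == v = ⌊ u ≟ v ⌋

adj : ∀ {n} → List (Edge n) → Fin n → Fin n → Bool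
adj [] u v = false
adj ((a , b) ∷ E) u v = ((a == u) ∧ (b == v)) ∨ ((a == v) ∧ (b == u)) ∨ adj E u v

conn : ∀ {n} → List (Edge n) → ℕ → Fin n → Fin n → Bool
conn E zero u v = u == v
conn {n} E (suc s) u v = conn E s u v ∨ any (λ w → conn E s u w ∧ adj E w v) (allFin n)

-- u and v lie in the same connected component (walks of length ≤ n suffice)
connected? : ∀ {n} → List (Edge n) → Fin n → Fin n → Bool
connected? {n} E u v = conn E n u v

count : ∀ {A : Set} → (A → Bool) → List A → ℕ
count P [] = 0
count P (x ∷ xs) = if P x then suc (count P xs) else count P xs

-- number of connected components of the spanning graph (Fin n , E):
-- the number of vertices v that are the smallest vertex of their component
κ : ∀ {n} → List (Edge n) → ℕ
κ {n} E = count (λ v → not (any (λ u → (toℕ u <ᵇ toℕ v) ∧ connected? E u v) (allFin n))) (allFin n)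

rank : ∀ {n} → List (Edge n) → ℕ
rank {n} E = n ∸ κ E

corank : ∀ {n} → List (Edge n) → ℕ
corank {n} E = (length E ℕ.+ κ E) ∸ n

-- all sub-lists (= spanning subgraphs, as edge subsets; one entry per subset
-- when E has no repeated edges)
subs : ∀ {A : Set} → List A → List (List A)
subs [] = [] ∷ []
subs (x ∷ xs) = subs xs ++ map (x ∷_) (subs xs)

record CGraph (n m : ℕ) : Set where
  field
    edges     : List (Edge n)
    ordered   : All (λ e → toℕ (proj₁ e) ℕ.< toℕ (proj₂ e)) edges
    noMulti   : Unique edges
    size      : length edges ≡ m
    connected : κ edges ≡ 1
open CGraph public

-- Whitney polynomial W_G(x,y) = Σ_{S ⊆ E} x^{r(G)-r(S)} y^{c(S)},
-- given by its coefficient array: coefficient of x^i y^j.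

wcoeff : ∀ {n} → List (Edge n) → ℕ → ℕ → ℕ
wcoeff E i j = count (λ S → ((rank E ∸ rank S) ≡ᵇ i) ∧ (corank S ≡ᵇ j)) (subs E)

ℕtoℚ : ℕ → ℚ
ℕtoℚ a = + a ℚ./ 1

-- A bivariate polynomial with rational coefficients: a finitely supported
-- coefficient array  q i j  (coefficient of x^i y^j).
FinSupp : (ℕ → ℕ → ℚ) → Set
FinSupp q = ∃[ D ] (∀ i j → (D ℕ.< i ⊎ D ℕ.< j) → q i j ≡ 0ℚ)

-- coefficient of x^i y^j in  x·y·Q(x,y)
shiftXY : (ℕ → ℕ → ℚ) → ℕ → ℕ → ℚ
shiftXY q (suc i) (suc j) = q i j
shiftXY q _ _ = 0ℚ

-- W_G - W_H = (1 - x y) Q  with Q nonnegative (coefficientwise)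
WhitneyDominates : ∀ {n m} → CGraph n m → CGraph n m → Set
WhitneyDominates G H =
  Σ (ℕ → ℕ → ℚ) λ q → FinSupp q × (∀ i j → 0ℚ ℚ.≤ q i j) ×
    (∀ i j → ℕtoℚ (wcoeff (edges G) i j) ℚ.- ℕtoℚ (wcoeff (edges H) i j)
             ≡ q i j ℚ.- shiftXY q i j)

WhitneyMaximum : ∀ {n m} → CGraph n m → Set
WhitneyMaximum {n} {m} G = ∀ (H : CGraph n m) → WhitneyDominates G H

Ncount : ∀ {n} → ℕ → List (Edge n) → ℕ → ℕ
Ncount k E i = count (λ S → (length S ≡ᵇ i) ∧ (κ S ℕ.≤ᵇ k)) (subs E)

_^ℚ_ : ℚ → ℕ → ℚ
p ^ℚ zero = 1ℚ
p ^ℚ suc e = p ℚ.* (p ^ℚ e)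

sumℚ : List ℚ → ℚ
sumℚ = foldr ℚ._+_ 0ℚ

reliability : ∀ {n} → ℕ → List (Edge n) → ℚ → ℚ
reliability k E p =
  sumℚ (map (λ i → ℕtoℚ (Ncount k E i) ℚ.* ((p ^ℚ i) ℚ.* ((1ℚ ℚ.- p) ^ℚ (length E ∸ i))))
            (upTo (suc (length E))))

-- k-uniformly most reliable (p ranging over the rationals in [0,1])
UniformlyMostReliable : ∀ {n m} → ℕ → CGraph n m → Set
UniformlyMostReliable {n} {m} k G =
  ∀ (H : CGraph n m) (p : ℚ) → 0ℚ ℚ.≤ p → p ℚ.≤ 1ℚ →
    reliability k (edges H) p ℚ.≤ reliability k (edges G) p

-- k-order edge connectivity, valued in ℕ ∪ {+∞} (nothing = +∞)

ℕ∞ : Set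
ℕ∞ = Maybe ℕ

data _≤∞_ : ℕ∞ → ℕ∞ → Set where
  fin≤fin : ∀ {a b} → a ℕ.≤ b → just a ≤∞ just b
  _≤inf   : ∀ x → x ≤∞ nothing

min∞ : ℕ∞ → ℕ∞ → ℕ∞
min∞ nothing y = y
min∞ (just a) nothing = just a
min∞ (just a) (just b) = just (a ℕ.⊓ b)

-- minimum of |E| - |S| over spanning subgraphs S with more than k components
-- (removing the edges of E not in S); +∞ if there is none
λk : ∀ {n} → ℕ → List (Edge n) → ℕ∞
λk k E = foldr min∞ nothing
  (map (λ S → if k ℕ.<ᵇ κ S then just (length E ∸ length S) else nothing) (subs E))

-- acyclic: no edge lies on a cycle, i.e. for every edge {a,b} of S,
-- a and b are not connected in S minus that edge
forestAux : ∀ {n} → List (Edge n) → List (Edge n) → Bool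
forestAux pre [] = true
forestAux pre ((a , b) ∷ post) =
  not (connected? (pre ++ post) a b) ∧ forestAux (pre ++ ((a , b) ∷ [])) post

isForest : ∀ {n} → List (Edge n) → Bool
isForest S = forestAux [] S

tk : ∀ {n} → ℕ → List (Edge n) → ℕ
tk k E = count (λ S → isForest S ∧ (κ S ≡ᵇ k)) (subs E)

-- For a connected graph on n vertices, a spanning subgraph with i edges and j + 1 components
-- is counted by the Whitney coefficient of x^j y^(i+j+1-n), and always i + (j + 1) ≥ n.  So
-- N_i^(k), which counts those with j < k, is a sum of Whitney coefficients along a diagonal
-- x^j y^(c+j).  When W_G - W_H = (1 - xy)Q, the difference of these sums for G and H telescopes
-- to a single coefficient of xyQ, hence N_i^(k)(G) ≥ N_i^(k)(H) for all i and k.  This gives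
-- the reliability inequality term by term.  It also gives the inequality for λ^(k): G and H have
-- equally many i-edge subgraphs, so G has at most as many with more than k components as H.
-- Finally t_k is the coefficient of x^(k-1) y^0, where (1 - xy)Q agrees with Q ≥ 0.

module Submission where

open import Defs
open import Data.Nat using (ℕ; _≤_)
open import Data.Product using (_×_)

open import Data.Nat using (zero; suc; _+_; _∸_; _<_; z≤n; s≤s; _<ᵇ_; _≡ᵇ_; _≤ᵇ_)
import Data.Nat.Properties as ℕ
open import Data.Bool using (Bool; true; false; _∧_; _∨_; not; T; if_then_else_)
open import Data.Bool.Properties using (T?; T-≡; T-∧; T-∨; ∨-zeroʳ)
open import Data.Fin using (Fin; toℕ)
import Data.Fin.Properties as Fin
open import Data.List using (List; []; _∷_; _++_; length; map; allFin; upTo; foldr; lookup)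
import Data.List.Properties as List
open import Data.Bool.ListAction using (any)
open import Data.List.Relation.Unary.Any using (here; there)
import Data.List.Relation.Unary.Any.Properties as Any
open import Data.List.Relation.Unary.All as All using (All; []; _∷_)
open import Data.List.Relation.Unary.All.Properties using (¬Any⇒All¬)
open import Data.List.Relation.Unary.AllPairs using ([]; _∷_)
open import Data.List.Relation.Unary.Unique.Propositional using (Unique)
open import Data.List.Relation.Unary.Unique.Propositional.Properties using (allFin⁺)
open import Data.List.Membership.Propositional using (_∈_; find; lose)
open import Data.List.Membership.Propositional.Properties using (∈-allFin; ∈-lookup; ∈-++⁺ˡ; ∈-map⁺; ∈-map⁻)
open import Data.List.Relation.Binary.Permutation.Propositional using (_↭_; ↭-sym)
open import Data.List.Relation.Binary.Permutation.Propositional.Properties using (∈-resp-↭; ↭-length; shift; ++-comm)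
open import Data.Product using (Σ; ∃-syntax; _,_; proj₁; proj₂)
open import Data.Sum as Sum using (_⊎_; inj₁; inj₂)
open import Data.Empty using (⊥-elim)
open import Data.Unit using (tt)
open import Data.Maybe using (just; nothing)
open import Data.Maybe.Properties using (just-injective)
import Data.Integer as ℤ
import Data.Integer.Properties as ℤₚ
open import Data.Rational as ℚ using (ℚ; 0ℚ; 1ℚ)
import Data.Rational.Properties as ℚₚ
import Data.Nat.Coprimality as Coprime
open import Data.Rational.Solver using (module +-*-Solver)
open import Relation.Binary.Construct.Closure.ReflexiveTransitive as Star using (Star; ε; _◅_; _◅◅_)
open import Relation.Binary.Definitions using (tri<; tri≈; tri>)
open import Relation.Nullary using (¬_; yes; no)
open import Relation.Nullary.Decidable using (toWitness; fromWitness)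
open import Relation.Binary.PropositionalEquality
open import Function using (_∘_; case_of_; _⇔_; mk⇔; Equivalence)
open Equivalence using (to; from)

private variable
  A : Set
  n : ℕ

T-not : ∀ {x} → T (not x) ⇔ (¬ T x)
T-not {false} = mk⇔ (λ _ ()) (λ _ → tt)
T-not {true}  = mk⇔ (λ ()) (λ ¬t → ¬t tt)

T-∨-rest : ∀ x {y z} → T z → T (x ∨ y ∨ z)
T-∨-rest x {y} t = from (T-∨ {x}) (inj₂ (from (T-∨ {y}) (inj₂ t)))

T-∧-reassoc : ∀ x y z {w} → T (y ∧ z) ⇔ T w → T ((x ∧ y) ∧ z) ⇔ T (x ∧ w)
T-∧-reassoc false _ _ _   = mk⇔ (λ ()) (λ ())
T-∧-reassoc true  _ _ y∧z⇔w = y∧z⇔w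

count-++ : ∀ (P : A → Bool) xs ys → count P (xs ++ ys) ≡ count P xs + count P ys
count-++ P [] ys = refl
count-++ P (x ∷ xs) ys with P x
... | true  = cong suc (count-++ P xs ys)
... | false = count-++ P xs ys

count-map : ∀ {B : Set} (P : B → Bool) (f : A → B) xs → count P (map f xs) ≡ count (P ∘ f) xs
count-map P f [] = refl
count-map P f (x ∷ xs) with P (f x)
... | true  = cong suc (count-map P f xs)
... | false = count-map P f xs

count≤length : ∀ (P : A → Bool) xs → count P xs ≤ length xs
count≤length P [] = z≤n
count≤length P (x ∷ xs) with P x
... | true  = s≤s (count≤length P xs)
... | false = ℕ.m≤n⇒m≤1+n (count≤length P xs)

count≡length : ∀ {P : A → Bool} xs → (∀ x → T (P x)) → count P xs ≡ length xs
count≡length [] _ = refl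
count≡length {P = P} (x ∷ xs) all with P x | all x
... | true | _ = cong suc (count≡length xs all)

count≡0 : ∀ {P : A → Bool} {xs} → All (λ x → ¬ T (P x)) xs → count P xs ≡ 0
count≡0 [] = refl
count≡0 {P = P} {xs = x ∷ _} (¬px ∷ none) with P x
... | true  = ⊥-elim (¬px tt)
... | false = count≡0 none

count-mono : ∀ {P Q : A → Bool} xs → (∀ x → T (P x) → T (Q x)) → count P xs ≤ count Q xs
count-mono [] _ = z≤n
count-mono {P = P} {Q = Q} (x ∷ xs) P⇒Q with P x | Q x | P⇒Q x
... | true  | true  | _ = s≤s (count-mono xs P⇒Q)
... | true  | false | f = ⊥-elim (f tt)
... | false | true  | _ = ℕ.m≤n⇒m≤1+n (count-mono xs P⇒Q)
... | false | false | _ = count-mono xs P⇒Q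

count-cong : ∀ {P Q : A → Bool} xs → (∀ x → T (P x) ⇔ T (Q x)) → count P xs ≡ count Q xs
count-cong xs P⇔Q = ℕ.≤-antisym (count-mono xs (to ∘ P⇔Q)) (count-mono xs (from ∘ P⇔Q))

count-split : ∀ (P Q : A → Bool) xs →
  count P xs ≡ count (λ x → P x ∧ Q x) xs + count (λ x → P x ∧ not (Q x)) xs
count-split P Q [] = refl
count-split P Q (x ∷ xs) with P x | Q x
... | true  | true  = cong suc (count-split P Q xs)
... | true  | false = trans (cong suc (count-split P Q xs)) (sym (ℕ.+-suc _ _))
... | false | _     = count-split P Q xs

count-positive⁺ : ∀ {P : A → Bool} {x xs} → x ∈ xs → T (P x) → 0 < count P xs
count-positive⁺ {P = P} {xs = y ∷ _} (here refl) px with P y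
... | true = s≤s z≤n
count-positive⁺ {P = P} {xs = y ∷ _} (there x∈) px with P y
... | true  = s≤s z≤n
... | false = count-positive⁺ x∈ px

count-positive⁻ : ∀ (P : A → Bool) xs → 0 < count P xs → ∃[ x ] x ∈ xs × T (P x)
count-positive⁻ P (x ∷ xs) pos with P x in eq
... | true  = x , here refl , subst T (sym eq) tt
... | false with count-positive⁻ P xs pos
... | y , y∈ , py = y , there y∈ , py

count-subs-length : ∀ (P : ℕ → Bool) (E E' : List A) → length E ≡ length E' →
                    count (P ∘ length) (subs E) ≡ count (P ∘ length) (subs E')
count-subs-length P []      []        _         = refl
count-subs-length P (x ∷ E) (x' ∷ E') |E|+1=|E'|+1 = begin
  count (P ∘ length) (subs E ++ map (x ∷_) (subs E))
    ≡⟨ count-++ _ (subs E) _ ⟩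
  count (P ∘ length) (subs E) + count (P ∘ length) (map (x ∷_) (subs E))
    ≡⟨ cong₂ _+_ (count-subs-length P E E' |E|=|E'|) (count-map _ (x ∷_) (subs E)) ⟩
  count (P ∘ length) (subs E') + count (P ∘ suc ∘ length) (subs E)
    ≡⟨ cong (_ +_) (count-subs-length (P ∘ suc) E E' |E|=|E'|) ⟩
  count (P ∘ length) (subs E') + count (P ∘ suc ∘ length) (subs E')
    ≡⟨ cong₂ _+_ refl (count-map _ (x' ∷_) (subs E')) ⟨
  count (P ∘ length) (subs E') + count (P ∘ length) (map (x' ∷_) (subs E'))
    ≡⟨ count-++ _ (subs E') _ ⟨
  count (P ∘ length) (subs E' ++ map (x' ∷_) (subs E')) ∎
  where
  open ≡-Reasoning
  |E|=|E'| : length E ≡ length E'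
  |E|=|E'| = ℕ.suc-injective |E|+1=|E'|+1

lookup-injective : ∀ {xs : List A} → Unique xs → ∀ {i j} → lookup xs i ≡ lookup xs j → i ≡ j
lookup-injective {xs = _ ∷ _} _          {Fin.zero}  {Fin.zero}  _  = refl
lookup-injective {xs = _ ∷ _} (x∉xs ∷ _) {Fin.zero}  {Fin.suc j} eq = ⊥-elim (All.lookup x∉xs (∈-lookup j) eq)
lookup-injective {xs = _ ∷ _} (x∉xs ∷ _) {Fin.suc i} {Fin.zero}  eq = ⊥-elim (All.lookup x∉xs (∈-lookup i) (sym eq))
lookup-injective {xs = _ ∷ _} (_ ∷ uniq) {Fin.suc i} {Fin.suc j} eq = cong Fin.suc (lookup-injective uniq eq)

Unique⇒length≤ : ∀ {xs : List (Fin n)} → Unique xs → length xs ≤ n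
Unique⇒length≤ uniq = Fin.injective⇒≤ (lookup-injective uniq)

==⇒≡ : {u v : Fin n} → T (u == v) → u ≡ v
==⇒≡ = toWitness

≡⇒== : {u v : Fin n} → u ≡ v → T (u == v)
≡⇒== = fromWitness

==-refl : ∀ (u : Fin n) → (u == u) ≡ true
==-refl u = to T-≡ (≡⇒== {u = u} refl)

count-remove : ∀ (P : Fin n → Bool) {x xs} → Unique xs → x ∈ xs → T (P x) →
  count P xs ≡ suc (count (λ v → P v ∧ not (v == x)) xs)
count-remove P {x} {xs} uniq x∈ px = begin
  count P xs                                ≡⟨ count-split P (_== x) xs ⟩
  count (λ v → P v ∧ (v == x)) xs + rest   ≡⟨ cong (_+ rest) (count-cong xs P∧=x⇔=x) ⟩
  count (_== x) xs + rest                   ≡⟨ cong (_+ rest) (count-unique uniq x∈) ⟩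
  suc rest                                  ∎
  where
  open ≡-Reasoning
  rest : ℕ
  rest = count (λ v → P v ∧ not (v == x)) xs

  P∧=x⇔=x : ∀ v → T (P v ∧ (v == x)) ⇔ T (v == x)
  P∧=x⇔=x v = mk⇔ (proj₂ ∘ to T-∧) (λ v=x → from T-∧ (subst (T ∘ P) (sym (==⇒≡ v=x)) px , v=x))

  count-unique : ∀ {xs} → Unique xs → x ∈ xs → count (_== x) xs ≡ 1
  count-unique {y ∷ ys} (y∉ys ∷ _) (here refl) rewrite ==-refl y =
    cong suc (count≡0 (All.map (λ y≢v v=y → y≢v (sym (==⇒≡ v=y))) y∉ys))
  count-unique {y ∷ ys} (y∉ys ∷ uniq) (there x∈ys) with y == x in eq
  ... | true  = ⊥-elim (All.lookup y∉ys x∈ys (==⇒≡ (subst T (sym eq) tt)))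
  ... | false = count-unique uniq x∈ys

Adj : List (Edge n) → Fin n → Fin n → Set
Adj E u v = (u , v) ∈ E ⊎ (v , u) ∈ E

Reach : List (Edge n) → Fin n → Fin n → Set
Reach E = Star (Adj E)

Reach-sym : ∀ {E : List (Edge n)} {u v} → Reach E u v → Reach E v u
Reach-sym = Star.reverse Sum.swap

Reach-⊆ : ∀ {E E' : List (Edge n)} → (∀ {e} → e ∈ E → e ∈ E') → ∀ {u v} → Reach E u v → Reach E' u v
Reach-⊆ E⊆E' = Star.map (Sum.map E⊆E' E⊆E')

==∧==⇒≡ : ∀ {a b u v : Fin n} → T ((a == u) ∧ (b == v)) → (u , v) ≡ (a , b)
==∧==⇒≡ t = let a=u , b=v = to T-∧ t in cong₂ _,_ (sym (==⇒≡ a=u)) (sym (==⇒≡ b=v))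

adj⇒Adj : ∀ (E : List (Edge n)) {u v} → T (adj E u v) → Adj E u v
adj⇒Adj ((a , b) ∷ E) t with to T-∨ t
... | inj₁ ab=uv = inj₁ (here (==∧==⇒≡ ab=uv))
... | inj₂ t' with to T-∨ t'
... | inj₁ ab=vu = inj₂ (here (==∧==⇒≡ ab=vu))
... | inj₂ t'' = Sum.map there there (adj⇒Adj E t'')

Adj⇒adj : ∀ (E : List (Edge n)) {u v} → Adj E u v → T (adj E u v)
Adj⇒adj ((a , b) ∷ E) (inj₁ (here refl)) rewrite ==-refl a | ==-refl b = tt
Adj⇒adj ((a , b) ∷ E) (inj₂ (here refl)) rewrite ==-refl a | ==-refl b | ∨-zeroʳ ((a == b) ∧ (b == a)) = tt
Adj⇒adj ((a , b) ∷ E) {u} {v} (inj₁ (there e∈)) = T-∨-rest ((a == u) ∧ (b == v)) (Adj⇒adj E (inj₁ e∈))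
Adj⇒adj ((a , b) ∷ E) {u} {v} (inj₂ (there e∈)) = T-∨-rest ((a == u) ∧ (b == v)) (Adj⇒adj E (inj₂ e∈))

module _ {E : List (Edge n)} where
  open import Data.List.Membership.DecPropositional (Fin._≟_ {n}) using (_∈?_)

  conn-refl : ∀ s u → T (conn E s u u)
  conn-refl zero    u = ≡⇒== {u = u} refl
  conn-refl (suc s) u = from T-∨ (inj₁ (conn-refl s u))

  conn-▻ : ∀ s {u w v} → T (conn E s u w) → Adj E w v → T (conn E (suc s) u v)
  conn-▻ s {w = w} c a =
    from T-∨ (inj₂ (Any.any⁺ _ (lose (∈-allFin w) (from T-∧ (c , Adj⇒adj E a)))))

  conn-◅ : ∀ s {u w v} → Adj E u w → T (conn E s w v) → T (conn E (suc s) u v)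
  conn-◅ zero {u} a w=v rewrite ==⇒≡ w=v = conn-▻ zero (conn-refl zero u) a
  conn-◅ (suc s) a c with to T-∨ c
  ... | inj₁ c' = from T-∨ (inj₁ (conn-◅ s a c'))
  ... | inj₂ c' with find (Any.any⁻ _ (allFin n) c')
  ... | _ , _ , c∧a = conn-▻ (suc s) (conn-◅ s a (proj₁ (to T-∧ c∧a))) (adj⇒Adj E (proj₂ (to T-∧ c∧a)))

  conn⇒Reach : ∀ s {u v} → T (conn E s u v) → Reach E u v
  conn⇒Reach zero {u} u=v = subst (Reach E u) (==⇒≡ u=v) ε
  conn⇒Reach (suc s) c with to T-∨ c
  ... | inj₁ c' = conn⇒Reach s c'
  ... | inj₂ c' with find (Any.any⁻ _ (allFin n) c')
  ... | _ , _ , c∧a = conn⇒Reach s (proj₁ (to T-∧ c∧a)) ◅◅ Star.return (adj⇒Adj E (proj₂ (to T-∧ c∧a)))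

  visits : ∀ {u v} → Reach E u v → List (Fin n)
  visits {u} ε       = u ∷ []
  visits {u} (_ ◅ p) = u ∷ visits p

  Reach⇒conn : ∀ s {u v} (p : Reach E u v) → length (visits p) ≤ suc s → T (conn E s u v)
  Reach⇒conn s       {u} ε           _         = conn-refl s u
  Reach⇒conn zero        (_ ◅ ε)     (s≤s ())
  Reach⇒conn zero        (_ ◅ _ ◅ _) (s≤s ())
  Reach⇒conn (suc s)     (a ◅ p)     (s≤s len) = conn-◅ s a (Reach⇒conn s p len)

  SimpleReach : Fin n → Fin n → Set
  SimpleReach u v = Σ (Reach E u v) (Unique ∘ visits)

  simple-suffix : ∀ {u w v} (p : Reach E w v) → Unique (visits p) → u ∈ visits p → SimpleReach u v
  simple-suffix ε       uniq       (here refl) = ε , uniq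
  simple-suffix (a ◅ p) uniq       (here refl) = a ◅ p , uniq
  simple-suffix (_ ◅ p) (_ ∷ uniq) (there u∈) = simple-suffix p uniq u∈

  Reach⇒SimpleReach : ∀ {u v} → Reach E u v → SimpleReach u v
  Reach⇒SimpleReach ε = ε , [] ∷ []
  Reach⇒SimpleReach {u} (a ◅ p) with Reach⇒SimpleReach p
  ... | q , uniq with u ∈? visits q
  ...   | yes u∈ = simple-suffix q uniq u∈
  ...   | no  u∉ = a ◅ q , ¬Any⇒All¬ _ u∉ ∷ uniq

  -- connected? only follows walks with at most n edges; simple walks are that short.
  connected?⇔Reach : ∀ {u v} → T (connected? E u v) ⇔ Reach E u v
  connected?⇔Reach = mk⇔ (conn⇒Reach n) λ p →
    let q , uniq = Reach⇒SimpleReach p in Reach⇒conn n q (ℕ.m≤n⇒m≤1+n (Unique⇒length≤ uniq))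

length-allFin : ∀ n → length (allFin n) ≡ n
length-allFin n = List.length-tabulate {n = n} (λ i → i)

isLeast : List (Edge n) → Fin n → Bool
isLeast {n} E v = not (any (λ u → (toℕ u <ᵇ toℕ v) ∧ connected? E u v) (allFin n))

module _ {E : List (Edge n)} where

  isLeast-sound : ∀ {v} → T (isLeast E v) → ∀ u → toℕ u < toℕ v → ¬ Reach E u v
  isLeast-sound t u u<v u~v = to T-not t
    (Any.any⁺ _ (lose (∈-allFin u) (from T-∧ (ℕ.<⇒<ᵇ u<v , from connected?⇔Reach u~v))))

  isLeast-or-smaller : ∀ v → T (isLeast E v) ⊎ ∃[ u ] toℕ u < toℕ v × Reach E u v
  isLeast-or-smaller v with any (λ u → (toℕ u <ᵇ toℕ v) ∧ connected? E u v) (allFin n) in eq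
  ... | false = inj₁ tt
  ... | true with find (Any.any⁻ _ (allFin n) (subst T (sym eq) tt))
  ...   | u , _ , t = let u<v , u~v = to T-∧ t in inj₂ (u , ℕ.<ᵇ⇒< _ _ u<v , to connected?⇔Reach u~v)

  isLeast-complete : ∀ {v} → (∀ u → toℕ u < toℕ v → ¬ Reach E u v) → T (isLeast E v)
  isLeast-complete {v} least with isLeast-or-smaller v
  ... | inj₁ t = t
  ... | inj₂ (u , u<v , u~v) = ⊥-elim (least u u<v u~v)

  isLeast-unique : ∀ {x y} → T (isLeast E x) → T (isLeast E y) → Reach E x y → x ≡ y
  isLeast-unique {x} {y} x-least y-least x~y with ℕ.<-cmp (toℕ x) (toℕ y)
  ... | tri< x<y _ _ = ⊥-elim (isLeast-sound y-least x x<y x~y)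
  ... | tri≈ _ x=y _ = Fin.toℕ-injective x=y
  ... | tri> _ _ y<x = ⊥-elim (isLeast-sound x-least y y<x (Reach-sym x~y))

  ∃-isLeast : ∀ v → ∃[ r ] Reach E r v × T (isLeast E r)
  ∃-isLeast v = descend (suc (toℕ v)) v (ℕ.n<1+n _) ε
    where
    descend : ∀ bound w → toℕ w < bound → Reach E w v → ∃[ r ] Reach E r v × T (isLeast E r)
    descend (suc bound) w (s≤s w≤bound) w~v with isLeast-or-smaller w
    ... | inj₁ w-least = w , w~v , w-least
    ... | inj₂ (u , u<w , u~w) = descend bound u (ℕ.<-≤-trans u<w w≤bound) (u~w ◅◅ w~v)

κ-cong : ∀ {E E' : List (Edge n)} → (∀ {u v} → Reach E u v → Reach E' u v) →
         (∀ {u v} → Reach E' u v → Reach E u v) → κ E ≡ κ E'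
κ-cong {n} E⇒E' E'⇒E = count-cong (allFin n) λ v → mk⇔
  (λ t → isLeast-complete λ u u<v u~v → isLeast-sound t u u<v (E'⇒E u~v))
  (λ t → isLeast-complete λ u u<v u~v → isLeast-sound t u u<v (E⇒E' u~v))

κ-resp-↭ : ∀ {E E' : List (Edge n)} → E ↭ E' → κ E ≡ κ E'
κ-resp-↭ E↭E' = κ-cong (Reach-⊆ (∈-resp-↭ E↭E')) (Reach-⊆ (∈-resp-↭ (↭-sym E↭E')))

κ-[] : ∀ n → κ {n} [] ≡ n
κ-[] n = trans (count≡length (allFin n) all-least) (length-allFin n)
  where
  Reach-[] : ∀ {u v} → Reach [] u v → u ≡ v
  Reach-[] ε = refl
  Reach-[] (inj₁ () ◅ _)
  Reach-[] (inj₂ () ◅ _)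
  all-least : ∀ v → T (isLeast [] v)
  all-least v = isLeast-complete {v = v} λ u u<v u~v → ℕ.<-irrefl (cong toℕ (Reach-[] u~v)) u<v

κ-positive : ∀ (E : List (Edge (suc n))) → 0 < κ E
κ-positive E = count-positive⁺ {P = isLeast E} (∈-allFin Fin.zero) (isLeast-complete {E = E} λ u u<0 _ → ℕ.n≮0 u<0)

κ≤n : ∀ (E : List (Edge n)) → κ E ≤ n
κ≤n {n} E = subst (κ E ≤_) (length-allFin n) (count≤length (isLeast E) (allFin n))

module _ {S : List (Edge n)} {a b : Fin n} where

  ReachVia : Fin n → Fin n → Set
  ReachVia x y = Reach S x y ⊎ (Reach S x a × Reach S b y) ⊎ (Reach S x b × Reach S a y)

  ReachVia-◅ : ∀ {x w y} → Adj S x w → ReachVia w y → ReachVia x y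
  ReachVia-◅ s (inj₁ p)             = inj₁ (s ◅ p)
  ReachVia-◅ s (inj₂ (inj₁ (p , q))) = inj₂ (inj₁ (s ◅ p , q))
  ReachVia-◅ s (inj₂ (inj₂ (p , q))) = inj₂ (inj₂ (s ◅ p , q))

  ReachVia-a◅ : ∀ {y} → ReachVia b y → ReachVia a y
  ReachVia-a◅ (inj₁ b~y)               = inj₂ (inj₁ (ε , b~y))
  ReachVia-a◅ (inj₂ (inj₁ (b~a , b~y))) = inj₁ (Reach-sym b~a ◅◅ b~y)
  ReachVia-a◅ (inj₂ (inj₂ (_ , a~y)))   = inj₁ a~y

  ReachVia-b◅ : ∀ {y} → ReachVia a y → ReachVia b y
  ReachVia-b◅ (inj₁ a~y)               = inj₂ (inj₂ (ε , a~y))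
  ReachVia-b◅ (inj₂ (inj₁ (_ , b~y)))   = inj₁ b~y
  ReachVia-b◅ (inj₂ (inj₂ (a~b , a~y))) = inj₁ (Reach-sym a~b ◅◅ a~y)

  Reach-∷⁻ : ∀ {x y} → Reach ((a , b) ∷ S) x y → ReachVia x y
  Reach-∷⁻ ε                      = inj₁ ε
  Reach-∷⁻ (inj₁ (here refl) ◅ p)  = ReachVia-a◅ (Reach-∷⁻ p)
  Reach-∷⁻ (inj₂ (here refl) ◅ p)  = ReachVia-b◅ (Reach-∷⁻ p)
  Reach-∷⁻ (inj₁ (there e∈) ◅ p) = ReachVia-◅ (inj₁ e∈) (Reach-∷⁻ p)
  Reach-∷⁻ (inj₂ (there e∈) ◅ p) = ReachVia-◅ (inj₂ e∈) (Reach-∷⁻ p)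

  Reach-∷⁺ : ∀ {x y} → ReachVia x y → Reach ((a , b) ∷ S) x y
  Reach-∷⁺ (inj₁ x~y)             = Reach-⊆ there x~y
  Reach-∷⁺ (inj₂ (inj₁ (x~a , b~y))) = Reach-⊆ there x~a ◅◅ inj₁ (here refl) ◅ Reach-⊆ there b~y
  Reach-∷⁺ (inj₂ (inj₂ (x~b , a~y))) = Reach-⊆ there x~b ◅◅ inj₂ (here refl) ◅ Reach-⊆ there a~y

  κ-∷-connected : Reach S a b → κ ((a , b) ∷ S) ≡ κ S
  κ-∷-connected a~b = κ-cong (collapse ∘ Reach-∷⁻) (Reach-⊆ there)
    where
    collapse : ∀ {x y} → ReachVia x y → Reach S x y
    collapse (inj₁ x~y)               = x~y
    collapse (inj₂ (inj₁ (x~a , b~y))) = x~a ◅◅ a~b ◅◅ b~y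
    collapse (inj₂ (inj₂ (x~b , a~y))) = x~b ◅◅ Reach-sym a~b ◅◅ a~y

  -- Of the least vertices ra < rb of the components joined by ab, only rb stops being least.
  module _ {ra rb} (ra~a : Reach S ra a) (ra-least : T (isLeast S ra))
                   (rb~b : Reach S rb b) (rb-least : T (isLeast S rb)) (ra<rb : toℕ ra < toℕ rb) where

    isLeast-∷ : ∀ v → T (isLeast ((a , b) ∷ S) v) ⇔ T (isLeast S v ∧ not (v == rb))
    isLeast-∷ v = mk⇔ fwd bwd
      where
      fwd : T (isLeast ((a , b) ∷ S) v) → T (isLeast S v ∧ not (v == rb))
      fwd t = from T-∧ (isLeast-complete (λ u u<v → isLeast-sound {E = (a , b) ∷ S} t u u<v ∘ Reach-⊆ there)
                       , from T-not v≢rb)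
        where
        v≢rb : ¬ T (v == rb)
        v≢rb v=rb with refl ← ==⇒≡ v=rb =
          isLeast-sound {E = (a , b) ∷ S} t ra ra<rb (Reach-∷⁺ (inj₂ (inj₁ (ra~a , Reach-sym rb~b))))

      no-smaller : T (isLeast S v) → ¬ T (v == rb) → ∀ u → toℕ u < toℕ v → ¬ ReachVia u v
      no-smaller v-least v≢rb u u<v (inj₁ u~v) = isLeast-sound v-least u u<v u~v
      no-smaller v-least v≢rb u u<v (inj₂ (inj₁ (_ , b~v))) =
        v≢rb (≡⇒== (isLeast-unique v-least rb-least (Reach-sym b~v ◅◅ Reach-sym rb~b)))
      no-smaller v-least v≢rb u u<v (inj₂ (inj₂ (u~b , a~v)))
        with refl ← isLeast-unique v-least ra-least (Reach-sym a~v ◅◅ Reach-sym ra~a) =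
        isLeast-sound rb-least u (ℕ.<-trans u<v ra<rb) (u~b ◅◅ Reach-sym rb~b)

      bwd : T (isLeast S v ∧ not (v == rb)) → T (isLeast ((a , b) ∷ S) v)
      bwd t = let v-least , v≢rb = to T-∧ t in
        isLeast-complete λ u u<v u~v → no-smaller v-least (to T-not v≢rb) u u<v (Reach-∷⁻ u~v)

    κ-∷-merging : suc (κ ((a , b) ∷ S)) ≡ κ S
    κ-∷-merging = sym (trans (count-remove (isLeast S) (allFin⁺ n) (∈-allFin rb) rb-least)
                             (cong suc (sym (count-cong (allFin n) isLeast-∷))))

κ-∷-flip : ∀ (S : List (Edge n)) a b → κ ((a , b) ∷ S) ≡ κ ((b , a) ∷ S)
κ-∷-flip S a b = κ-cong (Star.map flip) (Star.map flip)
  where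
  flip : ∀ {a b x y} → Adj ((a , b) ∷ S) x y → Adj ((b , a) ∷ S) x y
  flip (inj₁ (here refl))  = inj₂ (here refl)
  flip (inj₂ (here refl))  = inj₁ (here refl)
  flip (inj₁ (there e∈)) = inj₁ (there e∈)
  flip (inj₂ (there e∈)) = inj₂ (there e∈)

κ-∷-separated : ∀ {S : List (Edge n)} {a b} → ¬ Reach S a b → suc (κ ((a , b) ∷ S)) ≡ κ S
κ-∷-separated {S = S} {a} {b} a≁b with ∃-isLeast a | ∃-isLeast b
... | ra , ra~a , ra-least | rb , rb~b , rb-least with ℕ.<-cmp (toℕ ra) (toℕ rb)
... | tri< ra<rb _ _ = κ-∷-merging ra~a ra-least rb~b rb-least ra<rb
... | tri≈ _ ra=rb _ with refl ← Fin.toℕ-injective ra=rb = ⊥-elim (a≁b (Reach-sym ra~a ◅◅ rb~b))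
... | tri> _ _ rb<ra = trans (cong suc (κ-∷-flip S a b)) (κ-∷-merging rb~b rb-least ra~a ra-least rb<ra)

κ≤1+κ-∷ : ∀ (S : List (Edge n)) e → κ S ≤ suc (κ (e ∷ S))
κ≤1+κ-∷ S (a , b) with T? (connected? S a b)
... | yes a~b = ℕ.m≤n⇒m≤1+n (ℕ.≤-reflexive (sym (κ-∷-connected (to (connected?⇔Reach {E = S}) a~b))))
... | no  a≁b = ℕ.≤-reflexive (sym (κ-∷-separated (a≁b ∘ from (connected?⇔Reach {E = S}))))

n≤length+κ : ∀ (S : List (Edge n)) → n ≤ length S + κ S
n≤length+κ {n} []      = ℕ.≤-reflexive (sym (κ-[] n))
n≤length+κ     (e ∷ S) = ℕ.≤-trans (n≤length+κ S) (begin
  length S + κ S             ≤⟨ ℕ.+-monoʳ-≤ (length S) (κ≤1+κ-∷ S e) ⟩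
  length S + suc (κ (e ∷ S)) ≡⟨ ℕ.+-suc (length S) _ ⟩
  length (e ∷ S) + κ (e ∷ S) ∎)
  where open ℕ.≤-Reasoning

module _ {n : ℕ} where

  forestAux⇒ : ∀ (pre post : List (Edge n)) → T (forestAux pre post) → κ (pre ++ post) + length post ≡ κ pre
  forestAux⇒ pre [] _ = trans (ℕ.+-identityʳ _) (cong κ (List.++-identityʳ pre))
  forestAux⇒ pre ((a , b) ∷ post) t = begin
    κ (pre ++ (a , b) ∷ post) + suc (length post)        ≡⟨ ℕ.+-suc _ (length post) ⟩
    suc (κ (pre ++ (a , b) ∷ post) + length post)        ≡⟨ cong (λ E → suc (κ E + length post)) (List.++-assoc pre _ post) ⟨
    suc (κ ((pre ++ (a , b) ∷ []) ++ post) + length post) ≡⟨ cong suc (forestAux⇒ (pre ++ (a , b) ∷ []) post rest) ⟩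
    suc (κ (pre ++ (a , b) ∷ []))                         ≡⟨ cong suc (κ-resp-↭ (++-comm pre ((a , b) ∷ []))) ⟩
    suc (κ ((a , b) ∷ pre))                               ≡⟨ κ-∷-separated (a≁b ∘ Reach-⊆ ∈-++⁺ˡ) ⟩
    κ pre                                                 ∎
    where
    open ≡-Reasoning
    a≁b : ¬ Reach (pre ++ post) a b
    a≁b = to T-not (proj₁ (to T-∧ t)) ∘ from connected?⇔Reach
    rest : T (forestAux (pre ++ (a , b) ∷ []) post)
    rest = proj₂ (to T-∧ t)

  forestAux⇐ : ∀ (pre post : List (Edge n)) → length (pre ++ post) + κ (pre ++ post) ≡ n → T (forestAux pre post)
  forestAux⇐ pre [] _ = tt
  forestAux⇐ pre ((a , b) ∷ post) tight = from T-∧ (from T-not (a≁b ∘ to connected?⇔Reach) , rest)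
    where
    S : List (Edge n)
    S = pre ++ post
    pre⟨ab⟩post↭ : pre ++ (a , b) ∷ post ↭ (a , b) ∷ S
    pre⟨ab⟩post↭ = shift (a , b) pre post
    a≁b : ¬ Reach S a b
    a≁b a~b = ℕ.<-irrefl refl (begin-strict
      n                                                   ≤⟨ n≤length+κ S ⟩
      length S + κ S                                      <⟨ ℕ.n<1+n _ ⟩
      length ((a , b) ∷ S) + κ S                          ≡⟨ cong (length ((a , b) ∷ S) +_) (κ-∷-connected a~b) ⟨
      length ((a , b) ∷ S) + κ ((a , b) ∷ S)              ≡⟨ cong₂ _+_ (↭-length pre⟨ab⟩post↭) (κ-resp-↭ pre⟨ab⟩post↭) ⟨
      length (pre ++ (a , b) ∷ post) + κ (pre ++ (a , b) ∷ post) ≡⟨ tight ⟩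
      n                                                   ∎)
      where open ℕ.≤-Reasoning
    rest : T (forestAux (pre ++ (a , b) ∷ []) post)
    rest = forestAux⇐ (pre ++ (a , b) ∷ []) post
             (subst (λ E → length E + κ E ≡ n) (sym (List.++-assoc pre _ post)) tight)

  isForest⇔ : ∀ (S : List (Edge n)) → T (isForest S) ⇔ (length S + κ S ≡ n)
  isForest⇔ S = mk⇔ (λ t → trans (ℕ.+-comm (length S) (κ S)) (trans (forestAux⇒ [] S t) (κ-[] n)))
                    (forestAux⇐ [] S)

≤ᵇ1+k∧≤ᵇk : ∀ c k → T ((c ≤ᵇ suc k) ∧ (c ≤ᵇ k)) ⇔ T (c ≤ᵇ k)
≤ᵇ1+k∧≤ᵇk c k = mk⇔ (proj₂ ∘ to T-∧)
  λ c≤k → from T-∧ (ℕ.≤⇒≤ᵇ (ℕ.m≤n⇒m≤1+n (ℕ.≤ᵇ⇒≤ c k c≤k)) , c≤k)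

≤ᵇ1+k∧≰ᵇk : ∀ c k → T ((c ≤ᵇ suc k) ∧ not (c ≤ᵇ k)) ⇔ T (c ≡ᵇ suc k)
≤ᵇ1+k∧≰ᵇk c k = mk⇔
  (λ t → let c≤1+k , c≰k = to T-∧ t in ℕ.≡⇒≡ᵇ c (suc k)
    (ℕ.≤-antisym (ℕ.≤ᵇ⇒≤ c (suc k) c≤1+k) (ℕ.≰⇒> (to T-not c≰k ∘ ℕ.≤⇒≤ᵇ))))
  (λ t → case ℕ.≡ᵇ⇒≡ c (suc k) t of λ where
    refl → from T-∧ ( ℕ.≤⇒≤ᵇ (ℕ.≤-refl {suc k})
                    , from T-not (ℕ.<-irrefl refl ∘ ℕ.≤ᵇ⇒≤ (suc k) k)))

≡ᵇ∧≡ᵇ⇒ : ∀ a b c d → T ((a ≡ᵇ b) ∧ (c ≡ᵇ d)) → a ≡ b × c ≡ d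
≡ᵇ∧≡ᵇ⇒ a b c d t = let a=b , c=d = to T-∧ t in ℕ.≡ᵇ⇒≡ a b a=b , ℕ.≡ᵇ⇒≡ c d c=d

≡∧≡⇒ᵇ : ∀ {a b c d} → a ≡ b → c ≡ d → T ((a ≡ᵇ b) ∧ (c ≡ᵇ d))
≡∧≡⇒ᵇ {a} {b} {c} {d} a=b c=d = from T-∧ (ℕ.≡⇒≡ᵇ a b a=b , ℕ.≡⇒≡ᵇ c d c=d)

exactCount : ℕ → List (Edge n) → ℕ → ℕ
exactCount k E i = count (λ S → (length S ≡ᵇ i) ∧ (κ S ≡ᵇ suc k)) (subs E)

Ncount-suc : ∀ k (E : List (Edge n)) i → Ncount (suc k) E i ≡ Ncount k E i + exactCount k E i
Ncount-suc k E i = trans (count-split _ (λ S → κ S ≤ᵇ k) (subs E)) (cong₂ _+_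
  (count-cong (subs E) λ S →
    T-∧-reassoc (length S ≡ᵇ i) (κ S ≤ᵇ suc k) (κ S ≤ᵇ k) (≤ᵇ1+k∧≤ᵇk (κ S) k))
  (count-cong (subs E) λ S →
    T-∧-reassoc (length S ≡ᵇ i) (κ S ≤ᵇ suc k) (not (κ S ≤ᵇ k)) (≤ᵇ1+k∧≰ᵇk (κ S) k)))

Ncount-zero : ∀ (E : List (Edge (suc n))) i → Ncount 0 E i ≡ 0
Ncount-zero E i = count≡0 (All.universal (λ S t →
  ℕ.n≮0 (ℕ.<-≤-trans (κ-positive S) (ℕ.≤ᵇ⇒≤ (κ S) 0 (proj₂ (to T-∧ t))))) (subs E))

exactCount-zero : ∀ k (E : List (Edge (suc n))) i → i + k < n → exactCount k E i ≡ 0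
exactCount-zero {n} k E i i+k<n = count≡0 (All.universal too-few (subs E))
  where
  too-few : ∀ S → ¬ T ((length S ≡ᵇ i) ∧ (κ S ≡ᵇ suc k))
  too-few S t with ≡ᵇ∧≡ᵇ⇒ (length S) i (κ S) (suc k) t
  ... | |S|=i , κS=1+k = ℕ.<⇒≱ i+k<n (ℕ.≤-pred (begin
    suc n               ≤⟨ n≤length+κ S ⟩
    length S + κ S      ≡⟨ cong₂ _+_ |S|=i κS=1+k ⟩
    i + suc k           ≡⟨ ℕ.+-suc i k ⟩
    suc (i + k)         ∎))
    where open ℕ.≤-Reasoning

-- The graph has suc n vertices, so rank E = n here and the corank of an i-edge subgraph with
-- k + 1 components is (i + k) ∸ n.
module Connected {n : ℕ} {E : List (Edge (suc n))} (E-connected : κ E ≡ 1) where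

  1+rank-drop : ∀ S → suc (rank E ∸ rank S) ≡ κ S
  1+rank-drop S = trans (cong (λ c → suc ((suc n ∸ c) ∸ rank S)) E-connected)
                        (1+n∸[1+n∸c] (κ S) (κ-positive S) (κ≤n S))
    where
    1+n∸[1+n∸c] : ∀ c → 0 < c → c ≤ suc n → suc (n ∸ (suc n ∸ c)) ≡ c
    1+n∸[1+n∸c] (suc c) _ (s≤s c≤n) = cong suc (ℕ.m∸[m∸n]≡n c≤n)

  rank-drop≡⇔ : ∀ S k → rank E ∸ rank S ≡ k ⇔ κ S ≡ suc k
  rank-drop≡⇔ S k = mk⇔ (λ drop=k → trans (sym (1+rank-drop S)) (cong suc drop=k))
                        (λ κS=1+k → ℕ.suc-injective (trans (1+rank-drop S) κS=1+k))

  exactCount-wcoeff : ∀ k i → n ≤ i + k → exactCount k E i ≡ wcoeff E k ((i + k) ∸ n)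
  exactCount-wcoeff k i n≤i+k = count-cong (subs E) λ S → mk⇔ (fwd S) (bwd S)
    where
    fwd : ∀ S → T ((length S ≡ᵇ i) ∧ (κ S ≡ᵇ suc k)) →
                T (((rank E ∸ rank S) ≡ᵇ k) ∧ (corank S ≡ᵇ (i + k) ∸ n))
    fwd S t with ≡ᵇ∧≡ᵇ⇒ (length S) i (κ S) (suc k) t
    ... | |S|=i , κS=1+k = ≡∧≡⇒ᵇ (from (rank-drop≡⇔ S k) κS=1+k)
                                  (cong (_∸ suc n) (trans (cong₂ _+_ |S|=i κS=1+k) (ℕ.+-suc i k)))

    bwd : ∀ S → T (((rank E ∸ rank S) ≡ᵇ k) ∧ (corank S ≡ᵇ (i + k) ∸ n)) →
                T ((length S ≡ᵇ i) ∧ (κ S ≡ᵇ suc k))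
    bwd S t with ≡ᵇ∧≡ᵇ⇒ (rank E ∸ rank S) k (corank S) ((i + k) ∸ n) t
    ... | drop=k , corank=c = ≡∧≡⇒ᵇ |S|=i κS=1+k
      where
      κS=1+k : κ S ≡ suc k
      κS=1+k = to (rank-drop≡⇔ S k) drop=k
      |S|+κS=1+|S|+k : length S + κ S ≡ suc (length S + k)
      |S|+κS=1+|S|+k = trans (cong (length S +_) κS=1+k) (ℕ.+-suc (length S) k)
      |S|=i : length S ≡ i
      |S|=i = ℕ.+-cancelʳ-≡ k (length S) i (ℕ.∸-cancelʳ-≡
        (ℕ.≤-pred (subst (suc n ≤_) |S|+κS=1+|S|+k (n≤length+κ S))) n≤i+k
        (trans (sym (cong (_∸ suc n) |S|+κS=1+|S|+k)) corank=c))

  tk-wcoeff : ∀ k → tk (suc k) E ≡ wcoeff E k 0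
  tk-wcoeff k = count-cong (subs E) λ S → mk⇔ (fwd S) (bwd S)
    where
    fwd : ∀ S → T (isForest S ∧ (κ S ≡ᵇ suc k)) → T (((rank E ∸ rank S) ≡ᵇ k) ∧ (corank S ≡ᵇ 0))
    fwd S t = let forest , κS=1+k = to T-∧ t in
      ≡∧≡⇒ᵇ (from (rank-drop≡⇔ S k) (ℕ.≡ᵇ⇒≡ (κ S) (suc k) κS=1+k))
            (trans (cong (_∸ suc n) (to (isForest⇔ S) forest)) (ℕ.n∸n≡0 (suc n)))

    bwd : ∀ S → T (((rank E ∸ rank S) ≡ᵇ k) ∧ (corank S ≡ᵇ 0)) → T (isForest S ∧ (κ S ≡ᵇ suc k))
    bwd S t = let drop=k , corank=0 = ≡ᵇ∧≡ᵇ⇒ (rank E ∸ rank S) k (corank S) 0 t in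
      from T-∧ ( from (isForest⇔ S) (ℕ.≤-antisym (ℕ.m∸n≡0⇒m≤n corank=0) (n≤length+κ S))
               , ℕ.≡⇒≡ᵇ (κ S) (suc k) (to (rank-drop≡⇔ S k) drop=k))

ℕtoℚ≡mkℚ : ∀ a → ℕtoℚ a ≡ ℚ.mkℚ (ℤ.+ a) 0 (Coprime.sym (Coprime.1-coprimeTo a))
ℕtoℚ≡mkℚ a = ℚₚ.normalize-coprime (Coprime.sym (Coprime.1-coprimeTo a))

ℕtoℚ-+ : ∀ a b → ℕtoℚ (a + b) ≡ ℕtoℚ a ℚ.+ ℕtoℚ b
ℕtoℚ-+ a b rewrite ℕtoℚ≡mkℚ a | ℕtoℚ≡mkℚ b =
  cong (ℚ._/ 1) (cong₂ ℤ._+_ (sym (ℤₚ.*-identityʳ (ℤ.+ a))) (sym (ℤₚ.*-identityʳ (ℤ.+ b))))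

ℕtoℚ-mono-≤ : ∀ {a b} → a ≤ b → ℕtoℚ a ℚ.≤ ℕtoℚ b
ℕtoℚ-mono-≤ {a} {b} a≤b rewrite ℕtoℚ≡mkℚ a | ℕtoℚ≡mkℚ b =
  ℚ.*≤* (subst₂ ℤ._≤_ (sym (ℤₚ.*-identityʳ (ℤ.+ a))) (sym (ℤₚ.*-identityʳ (ℤ.+ b))) (ℤ.+≤+ a≤b))

ℕtoℚ-cancel-≤ : ∀ {a b} → ℕtoℚ a ℚ.≤ ℕtoℚ b → a ≤ b
ℕtoℚ-cancel-≤ {a} {b} a≤b rewrite ℕtoℚ≡mkℚ a | ℕtoℚ≡mkℚ b =
  ℤₚ.drop‿+≤+ (subst₂ ℤ._≤_ (ℤₚ.*-identityʳ (ℤ.+ a)) (ℤₚ.*-identityʳ (ℤ.+ b))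
                        (ℚₚ.drop-*≤* a≤b))

0≤x-y⇒y≤x : ∀ {x y} → 0ℚ ℚ.≤ x ℚ.- y → y ℚ.≤ x
0≤x-y⇒y≤x {x} {y} 0≤x-y = subst₂ ℚ._≤_ (ℚₚ.+-identityʳ y) (y+[x-y]≡x x y) (ℚₚ.+-monoʳ-≤ y 0≤x-y)
  where
  open +-*-Solver using (solve; _:+_; _:-_; _:=_)
  y+[x-y]≡x : ∀ x y → y ℚ.+ (x ℚ.- y) ≡ x
  y+[x-y]≡x = solve 2 (λ x y → y :+ (x :- y) := x) refl

y≤x⇒0≤x-y : ∀ {x y} → y ℚ.≤ x → 0ℚ ℚ.≤ x ℚ.- y
y≤x⇒0≤x-y {x} {y} y≤x = subst (ℚ._≤ x ℚ.- y) (ℚₚ.+-inverseʳ y) (ℚₚ.+-monoˡ-≤ (ℚ.- y) y≤x)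

shiftXY-0 : ∀ (q : ℕ → ℕ → ℚ) k → shiftXY q k 0 ≡ 0ℚ
shiftXY-0 q zero    = refl
shiftXY-0 q (suc k) = refl

shiftXY-nonneg : ∀ {q : ℕ → ℕ → ℚ} → (∀ i j → 0ℚ ℚ.≤ q i j) → ∀ k c → 0ℚ ℚ.≤ shiftXY q k c
shiftXY-nonneg q≥0 zero    c       = ℚₚ.≤-refl
shiftXY-nonneg q≥0 (suc k) zero    = ℚₚ.≤-refl
shiftXY-nonneg q≥0 (suc k) (suc c) = q≥0 k c

module Dominance {n m : ℕ} (G H : CGraph (suc n) m) (G≽H : WhitneyDominates G H) where
  open +-*-Solver using (solve; _:+_; _:-_; _:=_)

  q : ℕ → ℕ → ℚ
  q = proj₁ G≽H

  q≥0 : ∀ i j → 0ℚ ℚ.≤ q i j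
  q≥0 = proj₁ (proj₂ (proj₂ G≽H))

  W-diff : ∀ i j → ℕtoℚ (wcoeff (edges G) i j) ℚ.- ℕtoℚ (wcoeff (edges H) i j) ≡ q i j ℚ.- shiftXY q i j
  W-diff = proj₂ (proj₂ (proj₂ G≽H))

  module CG = Connected {E = edges G} (connected G)
  module CH = Connected {E = edges H} (connected H)

  -- Ncount-diff: N_i^(k)(G) - N_i^(k)(H) is the coefficient of x^k y^(i+k-n) in xyQ, because by
  -- exactCount-wcoeff its increments in k are differences of W_G - W_H along that diagonal.
  diagonal : ℕ → ℕ → ℚ
  diagonal i k = shiftXY q k ((i + k) ∸ n)

  _⊖_ : ℕ → ℕ → ℚ
  a ⊖ b = ℕtoℚ a ℚ.- ℕtoℚ b

  exactCount-diff-above : ∀ i k → n ≤ i + k →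
    exactCount k (edges G) i ⊖ exactCount k (edges H) i ≡ diagonal i (suc k) ℚ.- diagonal i k
  exactCount-diff-above i k n≤i+k = begin
    exactCount k (edges G) i ⊖ exactCount k (edges H) i
      ≡⟨ cong₂ _⊖_ (CG.exactCount-wcoeff k i n≤i+k) (CH.exactCount-wcoeff k i n≤i+k) ⟩
    wcoeff (edges G) k c ⊖ wcoeff (edges H) k c
      ≡⟨ W-diff k c ⟩
    shiftXY q (suc k) (suc c) ℚ.- diagonal i k
      ≡⟨ cong (λ j → shiftXY q (suc k) j ℚ.- diagonal i k) index ⟨
    diagonal i (suc k) ℚ.- diagonal i k ∎
    where
    open ≡-Reasoning
    c : ℕ
    c = (i + k) ∸ n
    index : (i + suc k) ∸ n ≡ suc c
    index = trans (cong (_∸ n) (ℕ.+-suc i k)) (ℕ.+-∸-assoc 1 n≤i+k)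

  exactCount-diff-below : ∀ i k → i + k < n →
    exactCount k (edges G) i ⊖ exactCount k (edges H) i ≡ diagonal i (suc k) ℚ.- diagonal i k
  exactCount-diff-below i k i+k<n = begin
    exactCount k (edges G) i ⊖ exactCount k (edges H) i
      ≡⟨ cong₂ _⊖_ (exactCount-zero k (edges G) i i+k<n) (exactCount-zero k (edges H) i i+k<n) ⟩
    0ℚ ℚ.- 0ℚ
      ≡⟨ cong₂ ℚ._-_ (shiftXY-0 q (suc k)) (shiftXY-0 q k) ⟨
    shiftXY q (suc k) 0 ℚ.- shiftXY q k 0
      ≡⟨ cong₂ (λ a b → shiftXY q (suc k) a ℚ.- shiftXY q k b)
               (ℕ.m≤n⇒m∸n≡0 i+1+k≤n) (ℕ.m≤n⇒m∸n≡0 (ℕ.<⇒≤ i+k<n)) ⟨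
    diagonal i (suc k) ℚ.- diagonal i k ∎
    where
    open ≡-Reasoning
    i+1+k≤n : i + suc k ≤ n
    i+1+k≤n = subst (_≤ n) (sym (ℕ.+-suc i k)) i+k<n

  exactCount-diff : ∀ i k →
    exactCount k (edges G) i ⊖ exactCount k (edges H) i ≡ diagonal i (suc k) ℚ.- diagonal i k
  exactCount-diff i k = Sum.[ exactCount-diff-above i k , exactCount-diff-below i k ]′ (ℕ.≤-<-connex n (i + k))

  Ncount-diff : ∀ i k → Ncount k (edges G) i ⊖ Ncount k (edges H) i ≡ diagonal i k
  Ncount-diff i zero = cong₂ _⊖_ (Ncount-zero (edges G) i) (Ncount-zero (edges H) i)
  Ncount-diff i (suc k) = begin
    Ncount (suc k) (edges G) i ⊖ Ncount (suc k) (edges H) i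
      ≡⟨ cong₂ _⊖_ (Ncount-suc k (edges G) i) (Ncount-suc k (edges H) i) ⟩
    (NG + eG) ⊖ (NH + eH)
      ≡⟨ cong₂ ℚ._-_ (ℕtoℚ-+ NG eG) (ℕtoℚ-+ NH eH) ⟩
    (ℕtoℚ NG ℚ.+ ℕtoℚ eG) ℚ.- (ℕtoℚ NH ℚ.+ ℕtoℚ eH)
      ≡⟨ regroup (ℕtoℚ NG) (ℕtoℚ NH) (ℕtoℚ eG) (ℕtoℚ eH) ⟩
    (NG ⊖ NH) ℚ.+ (eG ⊖ eH)
      ≡⟨ cong₂ ℚ._+_ (Ncount-diff i k) (exactCount-diff i k) ⟩
    diagonal i k ℚ.+ (diagonal i (suc k) ℚ.- diagonal i k)
      ≡⟨ telescope (diagonal i k) (diagonal i (suc k)) ⟩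
    diagonal i (suc k) ∎
    where
    open ≡-Reasoning
    NG NH eG eH : ℕ
    NG = Ncount k (edges G) i
    NH = Ncount k (edges H) i
    eG = exactCount k (edges G) i
    eH = exactCount k (edges H) i
    regroup : ∀ a b x y → (a ℚ.+ x) ℚ.- (b ℚ.+ y) ≡ (a ℚ.- b) ℚ.+ (x ℚ.- y)
    regroup = solve 4 (λ a b x y → (a :+ x) :- (b :+ y) := (a :- b) :+ (x :- y)) refl
    telescope : ∀ s t → s ℚ.+ (t ℚ.- s) ≡ t
    telescope = solve 2 (λ s t → s :+ (t :- s) := t) refl

  Ncount-mono : ∀ k i → Ncount k (edges H) i ≤ Ncount k (edges G) i
  Ncount-mono k i =
    ℕtoℚ-cancel-≤ (0≤x-y⇒y≤x (subst (0ℚ ℚ.≤_) (sym (Ncount-diff i k)) (shiftXY-nonneg q≥0 k _)))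

  wcoeff₀-mono : ∀ a → wcoeff (edges H) a 0 ≤ wcoeff (edges G) a 0
  wcoeff₀-mono a = ℕtoℚ-cancel-≤ (0≤x-y⇒y≤x (subst (0ℚ ℚ.≤_) (sym W-diff₀) (q≥0 a 0)))
    where
    W-diff₀ : wcoeff (edges G) a 0 ⊖ wcoeff (edges H) a 0 ≡ q a 0
    W-diff₀ = trans (W-diff a 0) (trans (cong (λ s → q a 0 ℚ.- s) (shiftXY-0 q a)) (ℚₚ.+-identityʳ (q a 0)))

  tk-mono : ∀ k → 0 < k → tk k (edges H) ≤ tk k (edges G)
  tk-mono (suc k) _ = subst₂ _≤_ (sym (CH.tk-wcoeff k)) (sym (CG.tk-wcoeff k)) (wcoeff₀-mono k)

*-nonneg : ∀ {x y} → 0ℚ ℚ.≤ x → 0ℚ ℚ.≤ y → 0ℚ ℚ.≤ x ℚ.* y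
*-nonneg {x} {y} 0≤x 0≤y =
  ℚₚ.nonNegative⁻¹ (x ℚ.* y) {{ℚₚ.nonNeg*nonNeg⇒nonNeg x {{ℚ.nonNegative 0≤x}} y {{ℚ.nonNegative 0≤y}}}}

^ℚ-nonneg : ∀ {x} → 0ℚ ℚ.≤ x → ∀ e → 0ℚ ℚ.≤ x ^ℚ e
^ℚ-nonneg 0≤x zero    = ℚ.*≤* (ℤ.+≤+ z≤n)
^ℚ-nonneg 0≤x (suc e) = *-nonneg 0≤x (^ℚ-nonneg 0≤x e)

sumℚ-mono : ∀ {f g : ℕ → ℚ} xs → (∀ i → f i ℚ.≤ g i) → sumℚ (map f xs) ℚ.≤ sumℚ (map g xs)
sumℚ-mono []       _   = ℚₚ.≤-refl
sumℚ-mono (x ∷ xs) f≤g = ℚₚ.+-mono-≤ (f≤g x) (sumℚ-mono xs f≤g)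

-- reliability k E unfolds to bernstein (length E) (Ncount k E).
bernstein : ℕ → (ℕ → ℕ) → ℚ → ℚ
bernstein L N p = sumℚ (map (λ i → ℕtoℚ (N i) ℚ.* ((p ^ℚ i) ℚ.* ((1ℚ ℚ.- p) ^ℚ (L ∸ i)))) (upTo (suc L)))

bernstein-mono : ∀ L {N N' : ℕ → ℕ} {p} → 0ℚ ℚ.≤ p → p ℚ.≤ 1ℚ → (∀ i → N' i ≤ N i) →
                 bernstein L N' p ℚ.≤ bernstein L N p
bernstein-mono L {p = p} 0≤p p≤1 N'≤N = sumℚ-mono (upTo (suc L)) λ i →
  ℚₚ.*-monoʳ-≤-nonNeg (basis i) {{ℚ.nonNegative (basis-nonneg i)}} (ℕtoℚ-mono-≤ (N'≤N i))
  where
  basis : ℕ → ℚ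
  basis i = (p ^ℚ i) ℚ.* ((1ℚ ℚ.- p) ^ℚ (L ∸ i))
  basis-nonneg : ∀ i → 0ℚ ℚ.≤ basis i
  basis-nonneg i = *-nonneg (^ℚ-nonneg 0≤p i) (^ℚ-nonneg (y≤x⇒0≤x-y p≤1) (L ∸ i))

reliability-mono : ∀ k (EG EH : List (Edge n)) → length EG ≡ length EH → (∀ i → Ncount k EH i ≤ Ncount k EG i) →
                   ∀ p → 0ℚ ℚ.≤ p → p ℚ.≤ 1ℚ → reliability k EH p ℚ.≤ reliability k EG p
reliability-mono k EG EH |EG|=|EH| N≤ p 0≤p p≤1 =
  subst (λ L → bernstein L (Ncount k EH) p ℚ.≤ reliability k EG p) |EG|=|EH|
        (bernstein-mono (length EG) 0≤p p≤1 N≤)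

≤∞-refl : ∀ x → x ≤∞ x
≤∞-refl nothing  = nothing ≤inf
≤∞-refl (just a) = fin≤fin ℕ.≤-refl

≤∞-trans : ∀ {x y z} → x ≤∞ y → y ≤∞ z → x ≤∞ z
≤∞-trans (fin≤fin a≤b) (fin≤fin b≤c) = fin≤fin (ℕ.≤-trans a≤b b≤c)
≤∞-trans {x} _ (_ ≤inf) = x ≤inf

min∞-≤ˡ : ∀ x y → min∞ x y ≤∞ x
min∞-≤ˡ nothing  y        = y ≤inf
min∞-≤ˡ (just a) nothing  = fin≤fin ℕ.≤-refl
min∞-≤ˡ (just a) (just b) = fin≤fin (ℕ.m⊓n≤m a b)

min∞-≤ʳ : ∀ x y → min∞ x y ≤∞ y
min∞-≤ʳ nothing  y        = ≤∞-refl y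
min∞-≤ʳ (just a) nothing  = just a ≤inf
min∞-≤ʳ (just a) (just b) = fin≤fin (ℕ.m⊓n≤n a b)

foldr-min∞-≤ : ∀ {ys y} → y ∈ ys → foldr min∞ nothing ys ≤∞ y
foldr-min∞-≤ {y ∷ ys} (here refl) = min∞-≤ˡ y _
foldr-min∞-≤ {y ∷ ys} (there y∈) = ≤∞-trans (min∞-≤ʳ y _) (foldr-min∞-≤ y∈)

foldr-min∞-∈ : ∀ ys {v} → foldr min∞ nothing ys ≡ just v → just v ∈ ys
foldr-min∞-∈ (nothing ∷ ys) min≡v = there (foldr-min∞-∈ ys min≡v)
foldr-min∞-∈ (just a ∷ ys) min≡v with foldr min∞ nothing ys in eq
... | nothing = here (sym min≡v)
... | just b with ℕ.⊓-sel a b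
...   | inj₁ a⊓b≡a = here (trans (sym min≡v) (cong just a⊓b≡a))
...   | inj₂ a⊓b≡b = there (foldr-min∞-∈ ys (trans eq (cong just (trans (sym a⊓b≡b) (just-injective min≡v)))))

cutValue : ℕ → List (Edge n) → List (Edge n) → ℕ∞
cutValue k E S = if k <ᵇ κ S then just (length E ∸ length S) else nothing

cutValue≡just⇔ : ∀ k (E S : List (Edge n)) {v} →
                 cutValue k E S ≡ just v ⇔ (k < κ S × length E ∸ length S ≡ v)
cutValue≡just⇔ k E S = mk⇔ cut⇒ cut⇐
  where
  cut⇒ : ∀ {v} → cutValue k E S ≡ just v → k < κ S × length E ∸ length S ≡ v
  cut⇒ eq with k <ᵇ κ S in k<κ
  ... | true = ℕ.<ᵇ⇒< k (κ S) (subst T (sym k<κ) tt) , just-injective eq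
  cut⇐ : ∀ {v} → k < κ S × length E ∸ length S ≡ v → cutValue k E S ≡ just v
  cut⇐ (k<κ , refl) = cong (if_then just (length E ∸ length S) else nothing) (to T-≡ (ℕ.<⇒<ᵇ k<κ))

λk-≤ : ∀ k {E S : List (Edge n)} → S ∈ subs E → k < κ S → λk k E ≤∞ just (length E ∸ length S)
λk-≤ k {E} {S} S∈ k<κ =
  subst (λk k E ≤∞_) (from (cutValue≡just⇔ k E S) (k<κ , refl)) (foldr-min∞-≤ (∈-map⁺ (cutValue k E) S∈))

λk-attained : ∀ k (E : List (Edge n)) {v} → λk k E ≡ just v →
              ∃[ S ] S ∈ subs E × k < κ S × length E ∸ length S ≡ v
λk-attained k E λ≡v with ∈-map⁻ (cutValue k E) (foldr-min∞-∈ (map (cutValue k E) (subs E)) λ≡v)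
... | S , S∈ , v≡cut = S , S∈ , to (cutValue≡just⇔ k E S) (sym v≡cut)

disconnectedAt : ℕ → ℕ → List (Edge n) → Bool
disconnectedAt k i S = (length S ≡ᵇ i) ∧ not (κ S ≤ᵇ k)

disconnectedAt⇔ : ∀ k i (S : List (Edge n)) → T (disconnectedAt k i S) ⇔ (length S ≡ i × k < κ S)
disconnectedAt⇔ k i S = mk⇔
  (λ t → let |S|=i , κ≰k = to T-∧ t in ℕ.≡ᵇ⇒≡ _ _ |S|=i , ℕ.≰⇒> (to T-not κ≰k ∘ ℕ.≤⇒≤ᵇ))
  (λ (|S|=i , k<κ) → from T-∧ (ℕ.≡⇒≡ᵇ _ _ |S|=i , from T-not (ℕ.<⇒≱ k<κ ∘ ℕ.≤ᵇ⇒≤ (κ S) k)))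

disconnectedCount-antitone : ∀ k (EG EH : List (Edge n)) → length EG ≡ length EH →
  (∀ i → Ncount k EH i ≤ Ncount k EG i) →
  ∀ i → count (disconnectedAt k i) (subs EG) ≤ count (disconnectedAt k i) (subs EH)
disconnectedCount-antitone k EG EH |EG|=|EH| N≤ i = ℕ.+-cancelˡ-≤ (Ncount k EG i) _ _ (begin
  Ncount k EG i + count (disconnectedAt k i) (subs EG) ≡⟨ size-split EG ⟨
  count (λ S → length S ≡ᵇ i) (subs EG)                ≡⟨ count-subs-length (_≡ᵇ i) EG EH |EG|=|EH| ⟩
  count (λ S → length S ≡ᵇ i) (subs EH)                ≡⟨ size-split EH ⟩
  Ncount k EH i + count (disconnectedAt k i) (subs EH) ≤⟨ ℕ.+-monoˡ-≤ _ (N≤ i) ⟩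
  Ncount k EG i + count (disconnectedAt k i) (subs EH) ∎)
  where
  open ℕ.≤-Reasoning
  size-split : ∀ E → count (λ S → length S ≡ᵇ i) (subs E) ≡ Ncount k E i + count (disconnectedAt k i) (subs E)
  size-split E = count-split (λ S → length S ≡ᵇ i) (λ S → κ S ≤ᵇ k) (subs E)

disconnected-transfer : ∀ k (EG EH : List (Edge n)) → length EG ≡ length EH →
  (∀ i → Ncount k EH i ≤ Ncount k EG i) → ∀ {S} → S ∈ subs EG → k < κ S →
  ∃[ S' ] S' ∈ subs EH × length S' ≡ length S × k < κ S'
disconnected-transfer k EG EH |EG|=|EH| N≤ {S} S∈ k<κS =
  let S' , S'∈ , t = count-positive⁻ (disconnectedAt k (length S)) (subs EH) (ℕ.<-≤-trans
                       (count-positive⁺ S∈ (from (disconnectedAt⇔ k (length S) S) (refl , k<κS)))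
                       (disconnectedCount-antitone k EG EH |EG|=|EH| N≤ (length S)))
  in S' , S'∈ , to (disconnectedAt⇔ k (length S) S') t

λk-mono : ∀ k (EG EH : List (Edge n)) → length EG ≡ length EH →
          (∀ i → Ncount k EH i ≤ Ncount k EG i) → λk k EH ≤∞ λk k EG
λk-mono k EG EH |EG|=|EH| N≤ with λk k EG in λG≡v
... | nothing = λk k EH ≤inf
... | just v with λk-attained k EG λG≡v
... | S , S∈ , k<κS , refl with disconnected-transfer k EG EH |EG|=|EH| N≤ S∈ k<κS
... | S' , S'∈ , |S'|=|S| , k<κS' =
  subst (λ l → λk k EH ≤∞ just l) (cong₂ _∸_ (sym |EG|=|EH|) |S'|=|S|) (λk-≤ k {EH} S'∈ k<κS')

theorem3 : ∀ (n m : ℕ) (G : CGraph n m) → WhitneyMaximum G →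
    ∀ (k : ℕ) → 1 ≤ k → k ≤ n →
      UniformlyMostReliable k G
      × (∀ (H : CGraph n m) → λk k (edges H) ≤∞ λk k (edges G))
      × (∀ (H : CGraph n m) → tk k (edges H) ≤ tk k (edges G))
theorem3 zero    m G _     k 1≤k k≤0 with () ← ℕ.≤-trans 1≤k k≤0
theorem3 (suc n) m G G-max k 1≤k _ =
    (λ H → reliability-mono k (edges G) (edges H) (same-size H) (Ncount-mono H))
  , (λ H → λk-mono k (edges G) (edges H) (same-size H) (Ncount-mono H))
  , (λ H → Dominance.tk-mono G H (G-max H) k 1≤k)
  where
  same-size : ∀ H → length (edges G) ≡ length (edges H)
  same-size H = trans (size G) (sym (size H))

  Ncount-mono : ∀ H i → Ncount k (edges H) i ≤ Ncount k (edges G) i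
  Ncount-mono H = Dominance.Ncount-mono G H (G-max H) k
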